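{- Let $\mathcal A=(Q,\Sigma,\delta,s,F)$ be a DFA satisfying the standing assumptions below, with $n=|Q|$. Then for any $\gamma,\gamma'\in\mathcal K(\mathcal A)$, $\gamma<\gamma'$ if and only if $suf_{2n}(\gamma)<suf_{2n}(\gamma')$; that is, the co-lex order of the infimum and supremum strings of $\mathcal A$ coincides with the co-lex order of their length-$2n$ suffixes.
   Context: A DFA is $\mathcal A=(Q,\Sigma,\delta,s,F)$ with finite state set $Q$, finite totally ordered alphabet $\Sigma$, (partial) transition function $\delta$, initial state $s$, final states $F$. Standing assumptions: $s$ has no incoming transitions; every state is reachable from $s$; all transitions entering a given state carry the same label. $I_q=\{\alpha\in\Sigma^*:\delta(s,\alpha)=q\}$. Strings may be finite or left-infinite $\omega$-strings; co-lex order on $\Sigma^*\cup\Sigma^\omega$: $\epsilon<\alpha$ for nonempty $\alpha$; for $\alpha=\alpha'a$, $\beta=\beta'b$ with $a,b$ characters, $\alpha<\beta$ iff $a<b$, or $a=b$ and $\alpha'<\beta'$. $\inf I_u$, $\sup I_u$ are the greatest lower bound and least upper bound of $I_u$; $\mathcal K(\mathcal A)=\{\inf I_u,\sup I_u:u\in Q\}$. For a string $\alpha$ and $k\ge0$, $suf_k(\alpha)$ is the length-$k$ suffix of $\alpha$, where if $|\alpha|<k$ it is left-padded with $k-|\alpha|$ copies of a symbol $\#\notin\Sigma$ with $\#<c$ for all $c\in\Sigma$. -}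

module Defs where

open import Data.Nat using (ℕ; zero; suc; _<ᵇ_) renaming (_<_ to _<ℕ_)
open import Data.Fin using (Fin) renaming (_<_ to _<ᶠ_; zero to fzero; suc to fsuc)
open import Data.Maybe using (Maybe; just; nothing; _>>=_; maybe)
open import Data.List using (List; []; _∷_; reverse)
open import Data.Product using (Σ; ∃; _×_; _,_)
open import Data.Sum using (_⊎_)
open import Data.Bool using (Bool; if_then_else_)
open import Relation.Binary.PropositionalEquality using (_≡_; _≢_)

-- Strings in Σ* ∪ Σ^ω (Σ = Fin σ, ordered by Fin's <), represented
-- "from the right": γ i is the i-th character counted from the right
-- end (i = 0 is the last character); nothing = the string has ended.

Str : ℕ → Set
Str σ = ℕ → Maybe (Fin σ)

WF : ∀ {σ} → Str σ → Set
WF γ = ∀ i → γ i ≡ nothing → γ (suc i) ≡ nothing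

data CharLt {σ : ℕ} : Maybe (Fin σ) → Maybe (Fin σ) → Set where
  end< : ∀ {b} → CharLt nothing (just b)
  chr< : ∀ {a b} → a <ᶠ b → CharLt (just a) (just b)

_<ˢ_ : ∀ {σ} → Str σ → Str σ → Set
γ <ˢ δ = ∃ λ k → (∀ i → i <ℕ k → γ i ≡ δ i) × CharLt (γ k) (δ k)

_≡ˢ_ : ∀ {σ} → Str σ → Str σ → Set
γ ≡ˢ δ = ∀ i → γ i ≡ δ i

_≤ˢ_ : ∀ {σ} → Str σ → Str σ → Set
γ ≤ˢ δ = γ <ˢ δ ⊎ γ ≡ˢ δ

index : ∀ {A : Set} → List A → ℕ → Maybe A
index [] _ = nothing
index (x ∷ xs) zero = just x
index (x ∷ xs) (suc i) = index xs i

fromList : ∀ {σ} → List (Fin σ) → Str σ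
fromList α = index (reverse α)

record DFA (n σ : ℕ) : Set where
  field
    δ : Fin n → Fin σ → Maybe (Fin n)
    s : Fin n
    F : Fin n → Bool

module _ {n σ : ℕ} (A : DFA n σ) where
  open DFA A

  run : Fin n → List (Fin σ) → Maybe (Fin n)
  run q [] = just q
  run q (a ∷ α) = δ q a >>= λ q' → run q' α

  InI : Fin n → List (Fin σ) → Set
  InI u α = run s α ≡ just u

  StandingAssumptions : Set
  StandingAssumptions =
    (∀ q a → δ q a ≢ just s)
    × (∀ q → ∃ λ α → run s α ≡ just q)
    × (∀ q q' a a' u → δ q a ≡ just u → δ q' a' ≡ just u → a ≡ a')

  IsLowerBound IsUpperBound : Fin n → Str σ → Set
  IsLowerBound u γ = ∀ α → InI u α → γ ≤ˢ fromList α
  IsUpperBound u γ = ∀ α → InI u α → fromList α ≤ˢ γ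

  IsInf : Fin n → Str σ → Set
  IsInf u γ = IsLowerBound u γ × (∀ β → WF β → IsLowerBound u β → β ≤ˢ γ)

  IsSup : Fin n → Str σ → Set
  IsSup u γ = IsUpperBound u γ × (∀ β → WF β → IsUpperBound u β → γ ≤ˢ β)

  InK : Str σ → Set
  InK γ = WF γ × (∃ λ u → IsInf u γ ⊎ IsSup u γ)

-- suf_k over the extended alphabet Σ ∪ {#}: Fin (suc σ), # = fzero,
-- c ∈ Σ ↦ fsuc c (so # < c for all c).

suf : ∀ {σ} → ℕ → Str σ → Str (suc σ)
suf k γ i = if i <ᵇ k then just (maybe fsuc fzero (γ i)) else nothing

-- Strings are read from the right, so
-- dropping the last character is the "tail". If u ≠ s, all words of I_u end with the same
-- letter a and I_u is the union of the I_v a over the a-predecessors v of u; hence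
-- inf I_u = a · min_v inf I_v, and (classically) the tail of inf I_u is itself some inf I_v;
-- dually for suprema. So the 2n kinds "inf I_u" and "sup I_u" form a Moore machine whose run
-- from the kind of γ spells out γ. In a Moore machine with m states, two states whose outputs
-- agree for m steps agree forever (the classes of "agree for j steps" refine strictly until they
-- stabilise). Thus two elements of 𝒦(𝒜) agreeing on their last 2n characters are equal, so
-- distinct ones already differ within their length-2n suffixes.
module Submission where

open import Defs
open import Data.Nat using (ℕ; _*_)
open import Function.Bundles using (_⇔_; mk⇔)

open import Level using (0ℓ)
open import Data.Nat using (zero; suc; _+_; _<ᵇ_; _<_; _≤_; _<?_; z≤n; s≤s)
open import Data.Nat.Properties
  using (≤-refl; <-trans; n≤1+n; m≤n⇒m≤1+n; ≤-<-trans; <-≤-trans; <⇒≱; ≮⇒≥; <-cmp; <⇒<ᵇ; <ᵇ⇒<; allUpTo?; +-identityʳ)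
open import Data.Nat.Induction using (<-rec)
open import Data.Fin as Fin using (Fin; splitAt; join; fromℕ) renaming (zero to fzero; suc to fsuc)
import Data.Fin.Properties as Finₚ
open import Data.Fin.Subset using (Subset; _∈_; _⊂_; ∣_∣)
open import Data.Fin.Subset.Properties using (∣p∣≤n; p⊂q⇒∣p∣<∣q∣)
open import Data.Vec using (tabulate)
open import Data.Vec.Properties using (lookup∘tabulate; []=⇒lookup; lookup⇒[]=)
open import Data.Maybe as Maybe using (Maybe; just; nothing; maybe)
open import Data.Maybe.Properties using (just-injective; ≡-dec)
open import Data.List using (List; []; _∷_; _∷ʳ_; [_]; reverse)
open import Data.List.Properties using (reverse-++)
open import Data.List.Reverse using (reverseView; []; _∶_∶ʳ_)
open import Data.Product using (Σ; ∃; ∃₂; _×_; _,_; proj₁; proj₂)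
open import Data.Sum as Sum using (_⊎_; inj₁; inj₂)
open import Data.Bool using (true; false)
open import Data.Unit using (tt)
open import Data.Empty using (⊥-elim)
open import Function using (_∘_; id; Equivalence)
open import Effect.Monad using (RawMonad)
open import Relation.Nullary using (¬_; Dec; yes; no; ¬?; _→-dec_; does; contradiction)
open import Relation.Nullary.Decidable using (decidable-stable; dec-true; ¬¬-excluded-middle)
open import Relation.Nullary.Negation using (DoubleNegation; ¬¬-Monad; call/cc)
open import Relation.Unary using (Pred; Decidable)
open import Relation.Binary using (Rel; DecidableEquality; Irreflexive; Transitive; Antisymmetric; Trichotomous; tri<; tri≈; tri>; _Respectsˡ_; _Respectsʳ_)
open import Relation.Binary.Structures using (IsStrictTotalOrder; IsStrictPartialOrder; IsPartialOrder)
import Relation.Binary.Construct.StrictToNonStrict as StrictToNonStrict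
import Relation.Binary.Construct.Flip.EqAndOrd as Flip
open import Relation.Binary.PropositionalEquality
  using (_≡_; _≢_; _≗_; refl; sym; trans; cong; subst; subst₂; resp₂; isEquivalence; _→-setoid_)
open import Relation.Binary.Bundles using (Setoid)

open RawMonad (¬¬-Monad {0ℓ}) using (pure; _>>=_; _<$>_)

¬¬-pull-Fin : ∀ {k} {P : Fin k → Set} → (∀ i → DoubleNegation (P i)) → DoubleNegation (∀ i → P i)
¬¬-pull-Fin {zero} _ = pure λ ()
¬¬-pull-Fin {suc k} p = do
  p₀ ← p fzero
  ps ← ¬¬-pull-Fin (p ∘ fsuc)
  pure λ { fzero → p₀ ; (fsuc i) → ps i }

minimal : ∀ {k} {P : Pred (Fin k) 0ℓ} → Decidable P → ∀ {t} → P t →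
          ∃ λ r → P r × (∀ t' → t' Fin.< r → ¬ P t')
minimal {suc k} P? pt with P? fzero
... | yes p₀ = fzero , p₀ , λ _ ()
minimal {suc k} P? {fzero} pt | no ¬p₀ = contradiction pt ¬p₀
minimal {suc k} P? {fsuc t} pt | no ¬p₀ with minimal (P? ∘ fsuc) pt
... | r , pr , r-min = fsuc r , pr , λ { fzero _ → ¬p₀ ; (fsuc t') (s≤s t'<r) → r-min t' t'<r }

module _ {k : ℕ} {P : Pred (Fin k) 0ℓ} (P? : Decidable P) where

  subsetOf : Subset k
  subsetOf = tabulate (does ∘ P?)

  ∈-subsetOf⁺ : ∀ {x} → P x → x ∈ subsetOf
  ∈-subsetOf⁺ {x} px = lookup⇒[]= x subsetOf (trans (lookup∘tabulate _ x) (dec-true (P? x) px))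

  ∈-subsetOf⁻ : ∀ {x} → x ∈ subsetOf → P x
  ∈-subsetOf⁻ {x} x∈ with P? x | trans (sym (lookup∘tabulate (does ∘ P?) x)) ([]=⇒lookup x∈)
  ... | yes px | _ = px
  ... | no _ | ()

subsetOf-⊂ : ∀ {k} {P Q : Pred (Fin k) 0ℓ} (P? : Decidable P) (Q? : Decidable Q) →
             (∀ {x} → P x → Q x) → ∀ {x} → Q x → ¬ P x → subsetOf P? ⊂ subsetOf Q?
subsetOf-⊂ P? Q? P⇒Q {x} qx ¬px =
  (λ y∈ → ∈-subsetOf⁺ Q? (P⇒Q (∈-subsetOf⁻ P? y∈))) , x , ∈-subsetOf⁺ Q? qx , ¬px ∘ ∈-subsetOf⁻ P?

module MooreMachine {m : ℕ} {O : Set} (_≟_ : DecidableEquality O)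
                    (next : Fin m → Fin m) (out : Fin m → O) where

  output : Fin m → ℕ → O
  output t zero    = out t
  output t (suc i) = output (next t) i

  Agree : ℕ → Fin m → Fin m → Set
  Agree j t t' = ∀ {i} → i < j → output t i ≡ output t' i

  agree? : ∀ j t t' → Dec (Agree j t t')
  agree? j t t' = allUpTo? (λ i → output t i ≟ output t' i) j

  Agree-≤ : ∀ {j k t t'} → k ≤ j → Agree j t t' → Agree k t t'
  Agree-≤ k≤j e i<k = e (<-≤-trans i<k k≤j)

  Agree-pred : ∀ {j t t'} → Agree (suc j) t t' → Agree j t t'
  Agree-pred = Agree-≤ (n≤1+n _)

  Agree-trans : ∀ {j t t' t''} → Agree j t t' → Agree j t' t'' → Agree j t t''
  Agree-trans e e' i<j = trans (e i<j) (e' i<j)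

  Agree-sym : ∀ {j t t'} → Agree j t t' → Agree j t' t
  Agree-sym e i<j = sym (e i<j)

  Stable : ℕ → Set
  Stable j = ∀ t t' → Agree j t t' → Agree (suc j) t t'

  stable? : ∀ j → Dec (Stable j)
  stable? j = Finₚ.all? λ t → Finₚ.all? λ t' → agree? j t t' →-dec agree? (suc j) t t'

  Stable⇒output≡ : ∀ {j t t'} → Stable j → Agree j t t' → ∀ i → output t i ≡ output t' i
  Stable⇒output≡ st e zero    = st _ _ e (s≤s z≤n)
  Stable⇒output≡ st e (suc i) = Stable⇒output≡ st (λ i<j → st _ _ e (s≤s i<j)) i

  -- Representatives of the Agree j-classes; their number grows with j until Agree j is stable.
  Least : ℕ → Fin m → Set
  Least j t = ∀ t' → t' Fin.< t → ¬ Agree j t' t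

  least? : ∀ j → Decidable (Least j)
  least? j t = Finₚ.all? λ t' → t' Finₚ.<? t →-dec ¬? (agree? j t' t)

  Least-suc : ∀ {j t} → Least j t → Least (suc j) t
  Least-suc l t' t'<t e = l t' t'<t (Agree-pred e)

  least-of-class : ∀ j t → ∃ λ r → Agree j r t × Least j r
  least-of-class j t with minimal (λ r → agree? j r t) {t} (λ _ → refl)
  ... | r , r~t , r-min = r , r~t , λ t' t'<r t'~r → r-min t' t'<r (Agree-trans t'~r r~t)

  Least-unique : ∀ {j r r'} → Least j r → Least j r' → Agree j r r' → r ≡ r'
  Least-unique {r = r} {r'} l l' e with Finₚ.<-cmp r r'
  ... | tri< r<r' _ _ = ⊥-elim (l' r r<r' e)
  ... | tri≈ _ r≡r' _ = r≡r'
  ... | tri> _ _ r'<r = ⊥-elim (l r' r'<r (Agree-sym e))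

  unstable-pair : ∀ {j} → ¬ Stable j → ∃₂ λ t t' → Agree j t t' × ¬ Agree (suc j) t t'
  unstable-pair {j} ¬st
    with Finₚ.¬∀⟶∃¬ m _ (λ t → Finₚ.all? λ t' → agree? j t t' →-dec agree? (suc j) t t') ¬st
  ... | t , ¬st-t with Finₚ.¬∀⟶∃¬ m _ (λ t' → agree? j t t' →-dec agree? (suc j) t t') ¬st-t
  ... | t' , ¬st-tt' with agree? j t t'
  ... | yes t~t' = t , t' , t~t' , λ e → ¬st-tt' (λ _ → e)
  ... | no ¬t~t' = ⊥-elim (¬st-tt' λ t~t' → ⊥-elim (¬t~t' t~t'))

  unstable⇒new-least : ∀ {j} → ¬ Stable j → ∃ λ w → Least (suc j) w × ¬ Least j w
  unstable⇒new-least {j} ¬st with unstable-pair ¬st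
  ... | t , t' , t~t' , t≁t' with least-of-class (suc j) t | least-of-class (suc j) t'
  ... | r , r~t , r-least | r' , r'~t' , r'-least with least? j r | least? j r'
  ... | no ¬r-least | _            = r , r-least , ¬r-least
  ... | yes _       | no ¬r'-least = r' , r'-least , ¬r'-least
  ... | yes r-least′ | yes r'-least′
    with Least-unique r-least′ r'-least′ (Agree-trans (Agree-pred r~t) (Agree-trans t~t' (Agree-sym (Agree-pred r'~t'))))
  ... | r≡r' = ⊥-elim (t≁t' (Agree-trans (Agree-sym r~t) (subst (λ x → Agree (suc j) x t') (sym r≡r') r'~t')))

  leasts : ℕ → Subset m
  leasts j = subsetOf (least? j)

  unstable⇒leasts< : ∀ {j} → ¬ Stable j → ∣ leasts j ∣ < ∣ leasts (suc j) ∣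
  unstable⇒leasts< {j} ¬st =
    let (w , w-least , ¬w-least) = unstable⇒new-least ¬st
    in p⊂q⇒∣p∣<∣q∣ (subsetOf-⊂ (least? j) (least? (suc j)) Least-suc w-least ¬w-least)

  stabilises : ∀ j → (∃ λ j' → j' < j × Stable j') ⊎ j ≤ ∣ leasts j ∣
  stabilises zero = inj₂ z≤n
  stabilises (suc j) with stabilises j | stable? j
  ... | inj₁ (j' , j'<j , st) | _      = inj₁ (j' , m≤n⇒m≤1+n j'<j , st)
  ... | inj₂ _                | yes st = inj₁ (j , ≤-refl , st)
  ... | inj₂ j≤#              | no ¬st = inj₂ (≤-<-trans j≤# (unstable⇒leasts< ¬st))

  Agree⇒output≡ : ∀ {t t'} → Agree m t t' → ∀ i → output t i ≡ output t' i
  Agree⇒output≡ e with stabilises (suc m)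
  ... | inj₁ (j , s≤s j≤m , st) = Stable⇒output≡ st (Agree-≤ j≤m e)
  ... | inj₂ 1+m≤#              = contradiction (∣p∣≤n (leasts (suc m))) (<⇒≱ 1+m≤#)

cons : ∀ {C : Set} → C → (ℕ → C) → ℕ → C
cons c γ zero    = c
cons c γ (suc i) = γ i

tail : ∀ {C : Set} → (ℕ → C) → ℕ → C
tail γ i = γ (suc i)

cons-tail : ∀ {C : Set} {γ : ℕ → C} {c} → γ 0 ≡ c → γ ≗ cons c (tail γ)
cons-tail γ₀≡c zero    = γ₀≡c
cons-tail γ₀≡c (suc i) = refl

module DescribedStrings {C : Set} (_≟_ : DecidableEquality C) {m : ℕ}
    (Describes : Fin m → (ℕ → C) → Set)
    (Describes-unique : ∀ {t γ γ'} → Describes t γ → Describes t γ' → γ ≗ γ')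
    (Describes-tail : ∀ {t γ} → Describes t γ → DoubleNegation (∃ λ t' → Describes t' (tail γ))) where

  Step : Fin m → Set
  Step t = (∃ λ γ → Describes t γ × ∃ λ t' → Describes t' (tail γ)) ⊎ ¬ ∃ (Describes t)

  step-¬¬ : ∀ t → DoubleNegation (Step t)
  step-¬¬ t = ¬¬-excluded-middle {A = ∃ (Describes t)} >>= λ where
    (yes (γ , d)) → (λ (t' , d') → inj₁ (γ , d , t' , d')) <$> Describes-tail d
    (no ¬d)       → pure (inj₂ ¬d)

  module Machine (step : ∀ t → Step t) where

    next-of : ∀ {t} → Step t → Fin m
    next-of (inj₁ (_ , _ , t' , _)) = t'
    next-of {t} (inj₂ _)            = t

    out-of : ∀ {t} → Step t → Maybe C
    out-of (inj₁ (γ , _)) = just (γ 0)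
    out-of (inj₂ _)       = nothing

    open MooreMachine (≡-dec _≟_) (next-of ∘ step) (out-of ∘ step)

    Describes⇒output : ∀ {t γ} → Describes t γ → ∀ i → output t i ≡ just (γ i)
    Describes⇒output {t} d zero with step t
    ... | inj₁ (γ' , d' , _) = cong just (sym (Describes-unique d d' 0))
    ... | inj₂ ¬d            = ⊥-elim (¬d (_ , d))
    Describes⇒output {t} d (suc i) with step t
    ... | inj₁ (γ' , d' , t' , d'') = trans (Describes⇒output d'' i) (cong just (sym (Describes-unique d d' (suc i))))
    ... | inj₂ ¬d                   = ⊥-elim (¬d (_ , d))

    prefix⇒≗ : ∀ {t t' γ γ'} → Describes t γ → Describes t' γ' →
               (∀ i → i < m → γ i ≡ γ' i) → γ ≗ γ'
    prefix⇒≗ {t} {t'} d d' agree i =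
      just-injective (trans (sym (Describes⇒output d i)) (trans (Agree⇒output≡ output≡ i) (Describes⇒output d' i)))
      where
      output≡ : Agree m t t'
      output≡ {j} j<m = trans (Describes⇒output d j) (trans (cong just (agree j j<m)) (sym (Describes⇒output d' j)))

  prefix⇒≗ : ∀ {t t' γ γ'} → Describes t γ → Describes t' γ' → (∀ i → i < m → γ i ≡ γ' i) → γ ≗ γ'
  prefix⇒≗ {γ = γ} {γ'} d d' agree i =
    decidable-stable (γ i ≟ γ' i) ((λ step → Machine.prefix⇒≗ step d d' agree i) <$> ¬¬-pull-Fin step-¬¬)

module Colex {C : Set} {_⊏_ : Rel C 0ℓ} (⊏-sto : IsStrictTotalOrder _≡_ _⊏_) where
  private module ⊏ = IsStrictTotalOrder ⊏-sto

  _⊑_ : Rel C 0ℓ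
  _⊑_ = StrictToNonStrict._≤_ _≡_ _⊏_

  ⊑-antisym : Antisymmetric _≡_ _⊑_
  ⊑-antisym = StrictToNonStrict.antisym _≡_ _⊏_ isEquivalence ⊏.trans ⊏.irrefl

  infix 4 _≺_ _≼_

  _≺_ : Rel (ℕ → C) 0ℓ
  γ ≺ γ' = ∃ λ k → (∀ i → i < k → γ i ≡ γ' i) × γ k ⊏ γ' k

  ≺-irrefl : Irreflexive _≗_ _≺_
  ≺-irrefl γ≗γ' (k , _ , γₖ⊏γ'ₖ) = ⊏.irrefl (γ≗γ' k) γₖ⊏γ'ₖ

  ≺-trans : Transitive _≺_
  ≺-trans {γ} {γ'} {γ''} (k , below , lt) (k' , below' , lt') with <-cmp k k'
  ... | tri< k<k' _ _ =
    k , (λ i i<k → trans (below i i<k) (below' i (<-trans i<k k<k'))) ,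
    subst (γ k ⊏_) (below' k k<k') lt
  ... | tri≈ _ refl _ = k , (λ i i<k → trans (below i i<k) (below' i i<k)) , ⊏.trans lt lt'
  ... | tri> _ _ k'<k =
    k' , (λ i i<k' → trans (below i (<-trans i<k' k'<k)) (below' i i<k')) ,
    subst (_⊏ γ'' k') (sym (below k' k'<k)) lt'

  ≺-respʳ-≗ : _≺_ Respectsʳ _≗_
  ≺-respʳ-≗ {γ} e (k , below , lt) = k , (λ i i<k → trans (below i i<k) (e i)) , subst (γ k ⊏_) (e k) lt

  ≺-respˡ-≗ : _≺_ Respectsˡ _≗_
  ≺-respˡ-≗ {γ} e (k , below , lt) = k , (λ i i<k → trans (sym (e i)) (below i i<k)) , subst (_⊏ γ k) (e k) lt

  ≺-isStrictPartialOrder : IsStrictPartialOrder _≗_ _≺_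
  ≺-isStrictPartialOrder = record
    { isEquivalence = Setoid.isEquivalence (ℕ →-setoid C)
    ; irrefl        = ≺-irrefl
    ; trans         = ≺-trans
    ; <-resp-≈      = ≺-respʳ-≗ , ≺-respˡ-≗
    }

  _≼_ : Rel (ℕ → C) 0ℓ
  _≼_ = StrictToNonStrict._≤_ _≗_ _≺_

  open IsPartialOrder (StrictToNonStrict.isPartialOrder _≗_ _≺_ ≺-isStrictPartialOrder) public
    using () renaming (refl to ≼-refl; trans to ≼-trans; antisym to ≼-antisym; ≲-respˡ-≈ to ≼-respˡ-≗; ≲-respʳ-≈ to ≼-respʳ-≗)

  ≺-≼-trans : ∀ {γ γ' γ''} → γ ≺ γ' → γ' ≼ γ'' → γ ≺ γ''
  ≺-≼-trans = StrictToNonStrict.<-≤-trans _≗_ _≺_ ≺-trans ≺-respʳ-≗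

  cons-≺ : ∀ c {γ γ'} → γ ≺ γ' → cons c γ ≺ cons c γ'
  cons-≺ c (k , below , lt) = suc k , (λ { zero _ → refl ; (suc i) (s≤s i<k) → below i i<k }) , lt

  cons-≼ : ∀ c {γ γ'} → γ ≼ γ' → cons c γ ≼ cons c γ'
  cons-≼ c (inj₁ γ≺γ') = inj₁ (cons-≺ c γ≺γ')
  cons-≼ c (inj₂ γ≗γ') = inj₂ λ { zero → refl ; (suc i) → γ≗γ' i }

  head-≼ : ∀ {γ γ'} → γ ≼ γ' → γ 0 ⊑ γ' 0
  head-≼ (inj₁ (zero , _ , lt))      = inj₁ lt
  head-≼ (inj₁ (suc k , below , _)) = inj₂ (below 0 (s≤s z≤n))
  head-≼ (inj₂ γ≗γ')                = inj₂ (γ≗γ' 0)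

  tail-≼ : ∀ {γ γ'} → γ 0 ≡ γ' 0 → γ ≼ γ' → tail γ ≼ tail γ'
  tail-≼ γ₀≡γ'₀ (inj₁ (zero , _ , lt))     = ⊥-elim (⊏.irrefl γ₀≡γ'₀ lt)
  tail-≼ _ (inj₁ (suc k , below , lt)) = inj₁ (k , (λ i i<k → below (suc i) (s≤s i<k)) , lt)
  tail-≼ _ (inj₂ γ≗γ')                 = inj₂ (γ≗γ' ∘ suc)

  ≮∧≯⇒≗ : ∀ {γ γ'} → ¬ γ ≺ γ' → ¬ γ' ≺ γ → γ ≗ γ'
  ≮∧≯⇒≗ {γ} {γ'} γ⊀γ' γ'⊀γ = <-rec _ agree
    where
    agree : ∀ i → (∀ {j} → j < i → γ j ≡ γ' j) → γ i ≡ γ' i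
    agree i below with ⊏.compare (γ i) (γ' i)
    ... | tri< lt _ _ = ⊥-elim (γ⊀γ' (i , (λ j → below) , lt))
    ... | tri≈ _ eq _ = eq
    ... | tri> _ _ gt = ⊥-elim (γ'⊀γ (i , (λ j j<i → sym (below j<i)) , gt))

  ≼⊎≻-¬¬ : ∀ γ γ' → DoubleNegation (γ ≼ γ' ⊎ γ' ≺ γ)
  ≼⊎≻-¬¬ γ γ' neither = neither (inj₁ (inj₂ (≮∧≯⇒≗ (neither ∘ inj₁ ∘ inj₁) (neither ∘ inj₂))))

  minimum-¬¬ : ∀ {k} (β : Fin k → ℕ → C) → Fin k → DoubleNegation (∃ λ v → ∀ w → β v ≼ β w)
  minimum-¬¬ {suc zero} β _ = pure (fzero , λ { fzero → ≼-refl })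
  minimum-¬¬ {suc (suc k)} β _ = do
    (v , v-min) ← minimum-¬¬ (β ∘ fsuc) fzero
    β₀≼βᵥ⊎βᵥ≺β₀ ← ≼⊎≻-¬¬ (β fzero) (β (fsuc v))
    pure (Sum.[ (λ β₀≼βᵥ → fzero , λ { fzero → ≼-refl ; (fsuc w) → ≼-trans β₀≼βᵥ (v-min w) })
              , (λ βᵥ≺β₀ → fsuc v , λ { fzero → inj₁ βᵥ≺β₀ ; (fsuc w) → v-min w }) ]′ β₀≼βᵥ⊎βᵥ≺β₀)

WF-tail : ∀ {σ} {γ : Str σ} → WF γ → WF (tail γ)
WF-tail wf = wf ∘ suc

WF-cons : ∀ {σ} a {γ : Str σ} → WF γ → WF (cons (just a) γ)
WF-cons a wf zero    ()
WF-cons a wf (suc i) = wf i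

fromList-∷ʳ : ∀ {σ} (α : List (Fin σ)) a → fromList (α ∷ʳ a) ≗ cons (just a) (fromList α)
fromList-∷ʳ α a zero    = cong (λ l → index l 0) (reverse-++ α [ a ])
fromList-∷ʳ α a (suc i) = cong (λ l → index l (suc i)) (reverse-++ α [ a ])

module Runs {n σ : ℕ} (A : DFA n σ) where
  open DFA A

  run-∷ʳ : ∀ q α a → run A q (α ∷ʳ a) ≡ (run A q α Maybe.>>= λ p → δ p a)
  run-∷ʳ q []      a with δ q a
  ... | nothing = refl
  ... | just _  = refl
  run-∷ʳ q (b ∷ α) a with δ q b
  ... | nothing = refl
  ... | just q' = run-∷ʳ q' α a

  InI-∷ʳ : ∀ {u v a} α → InI A v α → δ v a ≡ just u → InI A u (α ∷ʳ a)
  InI-∷ʳ {a = a} α α∈Iᵥ v→u = trans (run-∷ʳ s α a) (trans (cong (Maybe._>>= λ p → δ p a) α∈Iᵥ) v→u)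

  data Last (u : Fin n) : List (Fin σ) → Set where
    initial : s ≡ u → Last u []
    via     : ∀ {v α} a → InI A v α → δ v a ≡ just u → Last u (α ∷ʳ a)

  last : ∀ {u} α → InI A u α → Last u α
  last α α∈Iᵤ with reverseView α
  ... | [] = initial (just-injective α∈Iᵤ)
  ... | α' ∶ _ ∶ʳ a with run A s α' in α'∈Iᵥ | trans (sym (run-∷ʳ s α' a)) α∈Iᵤ
  ...   | just v | v→u = via a α'∈Iᵥ v→u

module Bounds {n σ : ℕ} (A : DFA n σ) (SA : StandingAssumptions A)
              {_⊏_ : Rel (Maybe (Fin σ)) 0ℓ} (⊏-sto : IsStrictTotalOrder _≡_ _⊏_) where
  open DFA A
  open Runs A
  open Colex ⊏-sto
  open IsStrictTotalOrder ⊏-sto using (_≟_)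

  private
    _≟ᴹ_ : DecidableEquality (Maybe (Fin n))
    _≟ᴹ_ = ≡-dec Finₚ._≟_

    no-entry-to-s : ∀ q a → δ q a ≢ just s
    no-entry-to-s = proj₁ SA

    reachable : ∀ q → ∃ λ α → InI A q α
    reachable = proj₁ (proj₂ SA)

    entries-share-label : ∀ {q q' a a' u} → δ q a ≡ just u → δ q' a' ≡ just u → a ≡ a'
    entries-share-label = proj₂ (proj₂ SA) _ _ _ _ _

  LowerBound : Fin n → Str σ → Set
  LowerBound u β = ∀ α → InI A u α → β ≼ fromList α

  -- Greatest only up to double negation, which is all the classical tail lemma can deliver.
  Glb : Fin n → Str σ → Set
  Glb u γ = WF γ × LowerBound u γ × (∀ β → WF β → LowerBound u β → DoubleNegation (β ≼ γ))

  Glb-unique : ∀ {u γ γ'} → Glb u γ → Glb u γ' → γ ≗ γ'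
  Glb-unique {γ = γ} {γ'} (wf , lb , glb) (wf' , lb' , glb') i = decidable-stable (γ i ≟ γ' i) do
    γ'≼γ ← glb γ' wf' lb'
    γ≼γ' ← glb' γ wf lb
    pure (≼-antisym γ≼γ' γ'≼γ i)

  Glb-resp : ∀ {u γ γ'} → WF γ' → γ ≗ γ' → Glb u γ → Glb u γ'
  Glb-resp wf' γ≗γ' (_ , lb , glb) =
    wf' , (λ α α∈Iᵤ → ≼-respˡ-≗ γ≗γ' (lb α α∈Iᵤ)) ,
    λ β wfβ lbβ → (λ β≼γ → ≼-respʳ-≗ γ≗γ' β≼γ) <$> glb β wfβ lbβ

  ¬Glb⇒above-¬¬ : ∀ {v x} → WF x → LowerBound v x → ¬ Glb v x →
                  DoubleNegation (∃ λ β → WF β × LowerBound v β × x ≺ β)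
  ¬Glb⇒above-¬¬ {x = x} wfx lbx ¬glb none = ¬glb (wfx , lbx , λ β wfβ lbβ →
    Sum.[ id , (λ x≺β → ⊥-elim (none (β , wfβ , lbβ , x≺β))) ]′ <$> ≼⊎≻-¬¬ β x)

  initial-only-ε : ∀ α → InI A s α → α ≡ []
  initial-only-ε α α∈Iₛ with last α α∈Iₛ
  ... | initial _     = refl
  ... | via a _ v→s = ⊥-elim (no-entry-to-s _ a v→s)

  Glb-tail-initial : ∀ {γ} → Glb s γ → DoubleNegation (Glb s (tail γ))
  Glb-tail-initial {γ} g@(wf , lb , glb) = do
    ε≼γ ← glb (fromList []) (λ _ _ → refl) (λ α α∈Iₛ → ≼-reflexive (initial-only-ε α α∈Iₛ))
    let γ≗ε = ≼-antisym (lb [] refl) ε≼γ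
    pure (Glb-resp (WF-tail wf) (λ i → trans (γ≗ε i) (sym (γ≗ε (suc i)))) g)
    where
    ≼-reflexive : ∀ {α} → α ≡ [] → fromList [] ≼ fromList α
    ≼-reflexive refl = ≼-refl

  -- least a is the ⊏-least character; it may need a letter a, as for the reversed order it is
  -- the greatest letter.
  module _ (least : Fin σ → Maybe (Fin σ)) (least-⊏ : ∀ a c → c ≢ least a → least a ⊏ c) where

    least-≼-index : ∀ a l → (λ _ → least a) ≼ index l
    least-≼-index a [] with nothing ≟ least a
    ... | yes nothing≡least = inj₂ λ _ → sym nothing≡least
    ... | no nothing≢least  = inj₁ (0 , (λ _ ()) , least-⊏ a nothing nothing≢least)
    least-≼-index a (c ∷ l) with just c ≟ least a
    ... | no c≢least  = inj₁ (0 , (λ _ ()) , least-⊏ a (just c) c≢least)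
    ... | yes c≡least =
      ≼-trans (inj₂ λ { zero → sym c≡least ; (suc i) → refl })
              (≼-respʳ-≗ (λ { zero → refl ; (suc i) → refl }) (cons-≼ (just c) (least-≼-index a l)))

    module Entry {v₀ a u} (v₀→u : δ v₀ a ≡ just u) where

      s≢u : s ≢ u
      s≢u s≡u = no-entry-to-s v₀ a (subst (λ w → δ v₀ a ≡ just w) (sym s≡u) v₀→u)

      cons-LowerBound : ∀ {β} → (∀ {v} → δ v a ≡ just u → LowerBound v β) → LowerBound u (cons (just a) β)
      cons-LowerBound lbs α α∈Iᵤ with last α α∈Iᵤ
      ... | initial s≡u = ⊥-elim (s≢u s≡u)
      ... | via {α = α'} b α'∈Iᵥ v→u with entries-share-label v→u v₀→u
      ...   | refl = ≼-respʳ-≗ (sym ∘ fromList-∷ʳ α' a) (cons-≼ (just a) (lbs v→u α' α'∈Iᵥ))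

      tail-LowerBound : ∀ {γ v} → LowerBound u γ → γ 0 ≡ just a → δ v a ≡ just u → LowerBound v (tail γ)
      tail-LowerBound lb γ₀≡a v→u α α∈Iᵥ =
        tail-≼ γ₀≡a (≼-respʳ-≗ (fromList-∷ʳ α a) (lb (α ∷ʳ a) (InI-∷ʳ α α∈Iᵥ v→u)))

      Glb-head : ∀ {γ} → Glb u γ → DoubleNegation (γ 0 ≡ just a)
      Glb-head (_ , lb , glb) = do
        a⋯≼γ ← glb (cons (just a) λ _ → least a) (WF-cons a λ _ e → e)
                   (cons-LowerBound λ _ α _ → least-≼-index a (reverse α))
        let (α₀ , α₀∈Iᵥ₀) = reachable v₀
            γ≼α₀a = ≼-respʳ-≗ (fromList-∷ʳ α₀ a) (lb (α₀ ∷ʳ a) (InI-∷ʳ α₀ α₀∈Iᵥ₀ v₀→u))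
        pure (⊑-antisym (head-≼ γ≼α₀a) (head-≼ a⋯≼γ))

      Above : Str σ → Fin n → Set
      Above x v = Σ (Str σ) λ β → WF β × x ≺ β × (δ v a ≡ just u → LowerBound v β)

      -- If tail γ were the Glb of no I_v, each I_v with δ(v, a) = u would have a lower bound
      -- strictly above tail γ, and a times the least of these would lie in between γ and I_u.
      some-Glb-tail : ∀ {γ} → Glb u γ → γ 0 ≡ just a → DoubleNegation (∃ λ v → Glb v (tail γ))
      some-Glb-tail {γ} (wf , lb , glb) γ₀≡a = call/cc λ no-Glb → do
        βs ← ¬¬-pull-Fin (above no-Glb)
        (m , m-min) ← minimum-¬¬ (proj₁ ∘ βs) v₀
        let (β , wfβ , x≺β , _) = βs m
        aβ≼γ ← glb (cons (just a) β) (WF-cons a wfβ) (cons-LowerBound λ {v} v→u α α∈Iᵥ →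
                   ≼-trans (m-min v) (proj₂ (proj₂ (proj₂ (βs v))) v→u α α∈Iᵥ))
        ⊥-elim (≺-irrefl (λ _ → refl)
                 (≺-≼-trans (≺-respˡ-≗ (sym ∘ cons-tail γ₀≡a) (cons-≺ (just a) x≺β)) aβ≼γ))
        where
        x : Str σ
        x = tail γ

        above-pred : ¬ ∃ (λ v → Glb v x) → ∀ {v} → δ v a ≡ just u → DoubleNegation (Above x v)
        above-pred no-Glb {v} v→u =
          (λ (β , wfβ , lbβ , x≺β) → β , wfβ , x≺β , λ _ → lbβ) <$>
          ¬Glb⇒above-¬¬ (WF-tail wf) (tail-LowerBound lb γ₀≡a v→u) (no-Glb ∘ (v ,_))

        above : ¬ ∃ (λ v → Glb v x) → ∀ v → DoubleNegation (Above x v)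
        above no-Glb v with δ v a ≟ᴹ just u
        ... | yes v→u = above-pred no-Glb v→u
        ... | no v↛u  = (λ (β , wfβ , x≺β , _) → β , wfβ , x≺β , λ v→u → ⊥-elim (v↛u v→u)) <$>
                        above-pred no-Glb v₀→u

    Glb-tail : ∀ {u γ} → Glb u γ → DoubleNegation (∃ λ v → Glb v (tail γ))
    Glb-tail {u} g with reachable u
    ... | α₀ , α₀∈Iᵤ with last α₀ α₀∈Iᵤ
    ... | initial refl = (s ,_) <$> Glb-tail-initial g
    ... | via a _ v₀→u = do
      γ₀≡a ← Entry.Glb-head v₀→u g
      Entry.some-Glb-tail v₀→u g γ₀≡a

CharLt-irrefl : ∀ {σ} → Irreflexive _≡_ (CharLt {σ})
CharLt-irrefl refl (chr< a<a) = Finₚ.<-irrefl refl a<a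

CharLt-trans : ∀ {σ} → Transitive (CharLt {σ})
CharLt-trans end<         (chr< _)   = end<
CharLt-trans (chr< a<b) (chr< b<c) = chr< (Finₚ.<-trans a<b b<c)

CharLt-cmp : ∀ {σ} → Trichotomous _≡_ (CharLt {σ})
CharLt-cmp nothing  nothing  = tri≈ (λ ()) refl (λ ())
CharLt-cmp nothing  (just _) = tri< end< (λ ()) (λ ())
CharLt-cmp (just _) nothing  = tri> (λ ()) (λ ()) end<
CharLt-cmp (just a) (just b) with Finₚ.<-cmp a b
... | tri< a<b a≢b a≯b = tri< (chr< a<b) (a≢b ∘ just-injective) λ { (chr< b<a) → a≯b b<a }
... | tri≈ a≮a refl _  = tri≈ (λ { (chr< a<a) → a≮a a<a }) refl (λ { (chr< a<a) → a≮a a<a })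
... | tri> a≮b a≢b b<a = tri> (λ { (chr< a<b) → a≮b a<b }) (a≢b ∘ just-injective) (chr< b<a)

CharLt-isStrictTotalOrder : ∀ {σ} → IsStrictTotalOrder _≡_ (CharLt {σ})
CharLt-isStrictTotalOrder = record
  { isStrictPartialOrder = record
    { isEquivalence = isEquivalence
    ; irrefl        = CharLt-irrefl
    ; trans         = CharLt-trans
    ; <-resp-≈      = resp₂ CharLt
    }
  ; compare = CharLt-cmp
  }

nothing-least : ∀ {σ} (a : Fin σ) (c : Maybe (Fin σ)) → c ≢ nothing → CharLt nothing c
nothing-least _ nothing  c≢nothing = ⊥-elim (c≢nothing refl)
nothing-least _ (just _) _         = end<

top : ∀ {σ} → Fin σ → Fin σ
top {suc k} _ = fromℕ k

top-greatest : ∀ {σ} (a : Fin σ) c → c ≢ just (top a) → CharLt c (just (top a))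
top-greatest a nothing _ = end<
top-greatest {suc k} a (just b) b≢top = chr< (Finₚ.≤∧≢⇒< (Finₚ.≤fromℕ b) (b≢top ∘ cong just))

module Kinds {n σ : ℕ} (A : DFA n σ) (SA : StandingAssumptions A) where
  module Inf = Bounds A SA (CharLt-isStrictTotalOrder {σ})
  module Sup = Bounds A SA (Flip.isStrictTotalOrder (CharLt-isStrictTotalOrder {σ}))
  module Supᶜ = Colex (Flip.isStrictTotalOrder (CharLt-isStrictTotalOrder {σ}))

  ≤ˢ⇒≽ : ∀ {γ γ' : Str σ} → γ ≤ˢ γ' → γ' Supᶜ.≼ γ
  ≤ˢ⇒≽ (inj₁ (k , below , lt)) = inj₁ (k , (λ i i<k → sym (below i i<k)) , lt)
  ≤ˢ⇒≽ (inj₂ γ≗γ')             = inj₂ (sym ∘ γ≗γ')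

  ≽⇒≤ˢ : ∀ {γ γ' : Str σ} → γ' Supᶜ.≼ γ → γ ≤ˢ γ'
  ≽⇒≤ˢ (inj₁ (k , below , lt)) = inj₁ (k , (λ i i<k → sym (below i i<k)) , lt)
  ≽⇒≤ˢ (inj₂ γ'≗γ)             = inj₂ (sym ∘ γ'≗γ)

  -- inj₁ u stands for inf I_u, inj₂ u for sup I_u.
  Glbᴷ : Fin n ⊎ Fin n → Str σ → Set
  Glbᴷ (inj₁ u) = Inf.Glb u
  Glbᴷ (inj₂ u) = Sup.Glb u

  Glbᴷ-unique : ∀ k {γ γ'} → Glbᴷ k γ → Glbᴷ k γ' → γ ≗ γ'
  Glbᴷ-unique (inj₁ _) = Inf.Glb-unique
  Glbᴷ-unique (inj₂ _) = Sup.Glb-unique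

  Glbᴷ-tail : ∀ k {γ} → Glbᴷ k γ → DoubleNegation (∃ λ k' → Glbᴷ k' (tail γ))
  Glbᴷ-tail (inj₁ _) g = (λ (v , g') → inj₁ v , g') <$> Inf.Glb-tail (λ _ → nothing) nothing-least g
  Glbᴷ-tail (inj₂ _) g = (λ (v , g') → inj₂ v , g') <$> Sup.Glb-tail (just ∘ top) top-greatest g

  InK⇒Glbᴷ : ∀ {γ} → InK A γ → ∃ λ k → Glbᴷ k γ
  InK⇒Glbᴷ (wf , u , inj₁ (lb , glb)) = inj₁ u , wf , lb , λ β wfβ lbβ → pure (glb β wfβ lbβ)
  InK⇒Glbᴷ (wf , u , inj₂ (ub , lub)) =
    inj₂ u , wf , (λ α α∈Iᵤ → ≤ˢ⇒≽ (ub α α∈Iᵤ)) ,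
    λ β wfβ ubβ → pure (≤ˢ⇒≽ (lub β wfβ λ α α∈Iᵤ → ≽⇒≤ˢ (ubβ α α∈Iᵤ)))

  Describes : Fin (n + n) → Str σ → Set
  Describes t = Glbᴷ (splitAt n t)

  describes : ∀ k {γ} → Glbᴷ k γ → Describes (join n n k) γ
  describes k {γ} = subst (λ k' → Glbᴷ k' γ) (sym (Finₚ.splitAt-join n n k))

  Describes-tail : ∀ {t γ} → Describes t γ → DoubleNegation (∃ λ t' → Describes t' (tail γ))
  Describes-tail {t} d = (λ (k , g) → join n n k , describes k g) <$> Glbᴷ-tail (splitAt n t) d

  InK-prefix⇒≗ : ∀ {γ γ'} → InK A γ → InK A γ' → (∀ i → i < n + n → γ i ≡ γ' i) → γ ≗ γ'
  InK-prefix⇒≗ γ∈K γ'∈K =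
    let (k , g) = InK⇒Glbᴷ γ∈K ; (k' , g') = InK⇒Glbᴷ γ'∈K
    in DescribedStrings.prefix⇒≗ (≡-dec Finₚ._≟_) Describes (λ {t} → Glbᴷ-unique (splitAt n t)) Describes-tail
         (describes k g) (describes k' g')

enc : ∀ {σ} → Maybe (Fin σ) → Fin (suc σ)
enc = maybe fsuc fzero

enc-injective : ∀ {σ} {x y : Maybe (Fin σ)} → enc x ≡ enc y → x ≡ y
enc-injective {x = nothing} {nothing} _    = refl
enc-injective {x = just _}  {just _}  refl = refl

CharLt⇔enc< : ∀ {σ} {x y : Maybe (Fin σ)} → CharLt x y ⇔ CharLt (just (enc x)) (just (enc y))
CharLt⇔enc< = mk⇔ to from
  where
  to : ∀ {x y} → CharLt x y → CharLt (just (enc x)) (just (enc y))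
  to end<         = chr< (s≤s z≤n)
  to (chr< a<b) = chr< (s≤s a<b)
  from : ∀ {x y} → CharLt (just (enc x)) (just (enc y)) → CharLt x y
  from {nothing} {just _}  _                = end<
  from {just _}  {just _}  (chr< (s≤s a<b)) = chr< a<b
  from {nothing} {nothing} (chr< ())
  from {just _}  {nothing} (chr< ())

suf-< : ∀ {σ K i} (γ : Str σ) → i < K → suf K γ i ≡ just (enc (γ i))
suf-< {K = K} {i} γ i<K with i <ᵇ K | <⇒<ᵇ i<K
... | true | _ = refl

suf-≮ : ∀ {σ K i} (γ : Str σ) → ¬ i < K → suf K γ i ≡ nothing
suf-≮ {K = K} {i} γ i≮K with i <ᵇ K | <ᵇ⇒< i K
... | true  | i<ᵇK⇒i<K = ⊥-elim (i≮K (i<ᵇK⇒i<K tt))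
... | false | _        = refl

<ˢ⇔suf<ˢ : ∀ {σ} K {γ γ' : Str σ} → ((∀ i → i < K → γ i ≡ γ' i) → γ ≡ˢ γ') →
           (γ <ˢ γ') ⇔ (suf K γ <ˢ suf K γ')
<ˢ⇔suf<ˢ K {γ} {γ'} agree⇒≡ = mk⇔ to from
  where
  suf-≡ : ∀ {i} → i < K → suf K γ i ≡ suf K γ' i ⇔ γ i ≡ γ' i
  suf-≡ {i} i<K = mk⇔
    (λ e → enc-injective (just-injective (trans (sym (suf-< γ i<K)) (trans e (suf-< γ' i<K)))))
    (λ e → trans (suf-< γ i<K) (trans (cong (just ∘ enc) e) (sym (suf-< γ' i<K))))

  to : γ <ˢ γ' → suf K γ <ˢ suf K γ'
  to (k , below , lt) with k <? K
  ... | yes k<K = k , (λ i i<k → Equivalence.from (suf-≡ (<-trans i<k k<K)) (below i i<k)) ,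
                  subst₂ CharLt (sym (suf-< γ k<K)) (sym (suf-< γ' k<K)) (Equivalence.to CharLt⇔enc< lt)
  ... | no k≮K  = ⊥-elim (CharLt-irrefl (agree⇒≡ (λ i i<K → below i (<-≤-trans i<K (≮⇒≥ k≮K))) k) lt)

  from : suf K γ <ˢ suf K γ' → γ <ˢ γ'
  from (k , below , lt) with k <? K
  ... | yes k<K = k , (λ i i<k → Equivalence.to (suf-≡ (<-trans i<k k<K)) (below i i<k)) ,
                  Equivalence.from CharLt⇔enc< (subst₂ CharLt (suf-< γ k<K) (suf-< γ' k<K) lt)
  ... | no k≮K  with subst₂ CharLt (suf-≮ γ k≮K) (suf-≮ γ' k≮K) lt
  ... | ()

corollary14 : ∀ {n σ : ℕ} (A : DFA n σ) → StandingAssumptions A →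
    ∀ γ γ' → InK A γ → InK A γ' →
    (γ <ˢ γ') ⇔ (suf (2 * n) γ <ˢ suf (2 * n) γ')
corollary14 {n} A SA γ γ' γ∈K γ'∈K =
  <ˢ⇔suf<ˢ (2 * n) λ agree → Kinds.InK-prefix⇒≗ A SA γ∈K γ'∈K λ i i<n+n →
    agree i (subst (i <_) (sym (cong (n +_) (+-identityʳ n))) i<n+n)
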